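{- Consider the BML dynamics with $m$ cars on $\mathbb{Z}_N\times\mathbb{Z}_N$, and for each time $t\ge0$ let $S_t=\{Y^1_t,\dots,Y^m_t\}\subseteq\mathbb{Z}_N$. If the system never attains speed one, then there is a time $T$ at which every maximal empty arc of $\mathbb{Z}_N\setminus S_T$ contains at most one point.
   Context: Write $\mathbb{Z}_N=\mathbb{Z}/N\mathbb{Z}$ and consider the torus $\mathbb{Z}_N\times\mathbb{Z}_N$; the first coordinate points vertically ("up" means increasing the first coordinate) and the second horizontally ("right" means increasing the second coordinate). A configuration consists of $m<N^2$ cars at distinct sites, each coloured red or blue. Each time step consists of two sub-steps. First all blue cars try to move simultaneously one step right: a blue car at $(i,j)$ fails to move if and only if for some $k\ge 0$ the sites $(i,j+1),\dots,(i,j+k)$ hold blue cars and $(i,j+k+1)$ holds a red car; all other blue cars move one step right. Then, in the resulting configuration, all red cars try to move simultaneously one step up: a red car at $(i,j)$ fails to move if and only if for some $k\ge0$ the sites $(i+1,j),\dots,(i+k,j)$ hold red cars and $(i+k+1,j)$ holds a blue car; all other red cars move one step up. A car that does not move in a step is blocked in that step; the system attains speed one if there is a finite time after which no car is ever blocked. Let $X^i_t$ be the position of car $i$ at time $t$, and define $\phi_t:\mathbb{Z}_N^2\to\mathbb{Z}_N$ by $\phi_t(a,b)=a+b-t \bmod N$ and $Y^i_t=\phi_t(X^i_t)$. A maximal empty arc at time $t$ is a set $\{y,y+1,\dots,y+l\}\subseteq\mathbb{Z}_N\setminus S_t$ of consecutive points (mod $N$) such that $y-1\in S_t$ and $y+l+1\in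 S_t$. -}

module Defs where

open import Data.Nat using (ℕ; zero; suc; _+_; _*_; _∸_; _<_; _≤_; NonZero)
open import Data.Nat.DivMod using (_%_; m%n<n)
open import Data.Fin using (Fin; toℕ; fromℕ<)
open import Data.Product using (Σ; ∃; _×_; _,_; proj₁; proj₂)
open import Data.Sum using (_⊎_)
open import Relation.Binary.PropositionalEquality using (_≡_)
open import Relation.Nullary using (¬_)

data Colour : Set where
  red blue : Colour

module BML (N : ℕ) .{{nz : NonZero N}} where

  _⊕_ : Fin N → ℕ → Fin N
  i ⊕ k = fromℕ< (m%n<n (toℕ i + k) N)

  -- a site (i , j): i = vertical coordinate, j = horizontal coordinate
  Site : Set
  Site = Fin N × Fin N

  up : Site → Site
  up (i , j) = (i ⊕ 1 , j)

  right : Site → Site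
  right (i , j) = (i , j ⊕ 1)

  Config : ℕ → Set
  Config m = Fin m → Site

  module Cars (m : ℕ) (col : Fin m → Colour) where

    Holds : Config m → Site → Colour → Set
    Holds x s κ = ∃ λ c → x c ≡ s × col c ≡ κ

    BlueBlocked : Config m → Fin m → Set
    BlueBlocked x c =
      ∃ λ (k : ℕ) →
        (∀ l → 1 ≤ l → l ≤ k → Holds x (proj₁ (x c) , proj₂ (x c) ⊕ l) blue)
        × Holds x (proj₁ (x c) , proj₂ (x c) ⊕ suc k) red

    RedBlocked : Config m → Fin m → Set
    RedBlocked x c =
      ∃ λ (k : ℕ) →
        (∀ l → 1 ≤ l → l ≤ k → Holds x (proj₁ (x c) ⊕ l , proj₂ (x c)) red)
        × Holds x (proj₁ (x c) ⊕ suc k , proj₂ (x c)) blue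

    BlueSubstep : Config m → Config m → Set
    BlueSubstep x x' = ∀ c →
      (col c ≡ red → x' c ≡ x c)
      × (col c ≡ blue → BlueBlocked x c → x' c ≡ x c)
      × (col c ≡ blue → ¬ BlueBlocked x c → x' c ≡ right (x c))

    RedSubstep : Config m → Config m → Set
    RedSubstep x x' = ∀ c →
      (col c ≡ blue → x' c ≡ x c)
      × (col c ≡ red → RedBlocked x c → x' c ≡ x c)
      × (col c ≡ red → ¬ RedBlocked x c → x' c ≡ up (x c))

    -- a run of the BML dynamics: X t is the configuration at time t,
    -- Z t the intermediate configuration after the blue sub-step of step t
    record Trajectory : Set where
      field
        X : ℕ → Config m
        Z : ℕ → Config m
        blueStep : ∀ t → BlueSubstep (X t) (Z t)
        redStep  : ∀ t → RedSubstep (Z t) (X (suc t))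

    module _ (tr : Trajectory) where
      open Trajectory tr

      -- car c is blocked in step t (the step from time t to time t+1)
      Blocked : Fin m → ℕ → Set
      Blocked c t = (col c ≡ blue × BlueBlocked (X t) c)
                  ⊎ (col c ≡ red × RedBlocked (Z t) c)

      AttainsSpeedOne : Set
      AttainsSpeedOne = ∃ λ T → ∀ t → T ≤ t → ∀ c → ¬ Blocked c t

      -- φ_t(a,b) = a + b - t mod N   (−t realised as + (N ∸ t % N))
      φ : ℕ → Site → Fin N
      φ t (a , b) = fromℕ< (m%n<n (toℕ a + toℕ b + (N ∸ t % N)) N)

      Y : Fin m → ℕ → Fin N
      Y c t = φ t (X t c)

      InS : ℕ → Fin N → Set
      InS t y = ∃ λ c → Y c t ≡ y

      -- {y, y+1, …, y+l} is a maximal empty arc of Z_N ∖ S_t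
      -- (y ⊕ (N ∸ 1) is y − 1 mod N)
      MaxEmptyArc : ℕ → Fin N → ℕ → Set
      MaxEmptyArc t y l =
        (∀ i → i ≤ l → ¬ InS t (y ⊕ i))
        × InS t (y ⊕ (N ∸ 1))
        × InS t (y ⊕ suc l)

{-# OPTIONS --safe #-}

-- Along a car's trajectory Y either stays put (the car moves) or drops by one (it
-- is blocked).  A blocked car has a neighbour at Y + 1 now or at Y one step later,
-- so an occupied point followed by an empty one stays occupied; hence an empty pair
-- p, p + 1 at time T was empty at all earlier times.  Before T the total clockwise
-- distance of the Y's from p therefore never grows, and it drops at every blocking.
-- If it stayed constant for N steps nobody was blocked, every car returned to its
-- site, and the deterministic dynamics would run blocking-free forever after: speed
-- one.  So it drops every N steps, impossible for T = (mN + 1)N since it starts at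
-- most mN.
module Submission where

open import Defs
open import Data.Fin using (Fin; toℕ; _≟_)
import Data.Fin as Fin
open import Data.Fin.Properties using (toℕ-fromℕ<; toℕ-injective; toℕ<n; fromℕ<-cong; any?)
open import Data.Nat using (ℕ; zero; suc; _+_; _*_; _∸_; _/_; _%_; _<_; _≤_; _≤′_; ≤′-refl; ≤′-step; NonZero; >-nonZero⁻¹; z≤n; s≤s; _<?_)
open import Data.Nat.DivMod using (m%n<n; m≡m%n+[m/n]*n; m%n%n≡m%n; %-distribˡ-+; [m+kn]%n≡m%n; m<n⇒m%n≡m; n%n≡0)
open import Data.Nat.Induction using (<-rec)
open import Data.Nat.Properties hiding (_≟_)
open import Algebra.Properties.CommutativeMonoid.Sum +-0-commutativeMonoid using (sum; sum-remove)
open import Data.Product using (∃; _×_; _,_; proj₁; proj₂)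
open import Data.Product.Properties using (≡-dec)
open import Data.Vec.Functional using (removeAt)
open import Data.Sum using (_⊎_; inj₁; inj₂; fromInj₂)
open import Function using (_∘_; id)
open import Function.Definitions using (Injective)
open import Relation.Binary.PropositionalEquality
  using (_≡_; _≢_; _≗_; refl; sym; trans; cong; subst; module ≡-Reasoning)
open import Relation.Nullary using (¬_; Dec; yes; no; contradiction)
open import Relation.Nullary.Decidable using (decidable-stable; _⊎-dec_)

-- Blocking is not decidable (the run of cars in front is unbounded), but case
-- analysis on it is still sound when the goal is decidable.
by-cases : ∀ {p q} {P : Set p} {Q : Set q} → Dec Q → (P → Q) → (¬ P → Q) → Q
by-cases q? f g = decidable-stable q? (λ ¬q → ¬q (g (¬q ∘ f)))

sum-mono-≤ : ∀ {n} {f g : Fin n → ℕ} → (∀ i → f i ≤ g i) → sum f ≤ sum g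
sum-mono-≤ {zero}  f≤g = z≤n
sum-mono-≤ {suc n} f≤g = +-mono-≤ (f≤g Fin.zero) (sum-mono-≤ (f≤g ∘ Fin.suc))

sum-mono-< : ∀ {n} {f g : Fin n → ℕ} → (∀ i → f i ≤ g i) → ∀ i → f i < g i → sum f < sum g
sum-mono-< {suc n} {f} {g} f≤g i fi<gi = begin-strict
  sum f                     ≡⟨ sum-remove f ⟩
  f i + sum (removeAt f i)  <⟨ +-mono-<-≤ fi<gi (sum-mono-≤ (f≤g ∘ Fin.punchIn i)) ⟩
  g i + sum (removeAt g i)  ≡⟨ sum-remove g ⟨
  sum g                     ∎
  where open ≤-Reasoning

sum-≤-* : ∀ {n b} {f : Fin n → ℕ} → (∀ i → f i ≤ b) → sum f ≤ n * b
sum-≤-* {zero}  f≤b = z≤n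
sum-≤-* {suc n} f≤b = +-mono-≤ (f≤b Fin.zero) (sum-≤-* (f≤b ∘ Fin.suc))

antitone-on : ∀ {f : ℕ → ℕ} {K} → (∀ u → u < K → f (suc u) ≤ f u) →
              ∀ {a b} → a ≤ b → b ≤ K → f b ≤ f a
antitone-on {f} step a≤b b≤K = go (≤⇒≤′ a≤b) b≤K
  where
    go : ∀ {a b} → a ≤′ b → b ≤ _ → f b ≤ f a
    go ≤′-refl             _    = ≤-refl
    go (≤′-step {b} a≤′b) 1+b≤K = ≤-trans (step b 1+b≤K) (go a≤′b (<⇒≤ 1+b≤K))

descent-by-windows : ∀ {f : ℕ → ℕ} {n K} → (∀ s → s + n ≤ K → f (s + n) < f s) →
                     ∀ j → j * n ≤ K → j + f (j * n) ≤ f 0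
descent-by-windows             drop zero    _        = ≤-refl
descent-by-windows {f} {n} {K} drop (suc j) [1+j]n≤K = begin
  suc j + f (n + j * n)    ≡⟨ cong (λ v → suc j + f v) (+-comm n (j * n)) ⟩
  suc j + f (j * n + n)    ≡⟨ +-suc j _ ⟨
  j + suc (f (j * n + n))  ≤⟨ +-monoʳ-≤ j (drop (j * n) (subst (_≤ K) (+-comm n (j * n)) [1+j]n≤K)) ⟩
  j + f (j * n)            ≤⟨ descent-by-windows drop j (≤-trans (m≤n+m (j * n) n) [1+j]n≤K) ⟩
  f 0                      ∎
  where open ≤-Reasoning

absent-by-periodicity : ∀ {ℓ} {P : ℕ → Set ℓ} {n s} .{{_ : NonZero n}} →
                        (∀ t → s ≤ t → P (t + n) → P t) →
                        (∀ t → s ≤ t → t < n + s → ¬ P t) →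
                        ∀ t → s ≤ t → ¬ P t
absent-by-periodicity {P = P} {n} {s} shift window = <-rec (λ t → s ≤ t → ¬ P t) absent
  where
    absent : ∀ t → (∀ {u} → u < t → s ≤ u → ¬ P u) → s ≤ t → ¬ P t
    absent t earlier s≤t with t <? n + s
    ... | yes t<n+s = window t s≤t t<n+s
    ... | no  t≮n+s = earlier t∸n<t s≤t∸n ∘ shift (t ∸ n) s≤t∸n ∘ subst P (sym t∸n+n≡t)
      where
        n+s≤t : n + s ≤ t
        n+s≤t = ≮⇒≥ t≮n+s
        t∸n+n≡t : t ∸ n + n ≡ t
        t∸n+n≡t = m∸n+n≡m (≤-trans (m≤m+n n s) n+s≤t)
        t∸n<t : t ∸ n < t
        t∸n<t = subst (t ∸ n <_) t∸n+n≡t (m<m+n (t ∸ n) (>-nonZero⁻¹ n))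
        s≤t∸n : s ≤ t ∸ n
        s≤t∸n = m+n≤o⇒m≤o∸n s (subst (_≤ t) (+-comm n s) n+s≤t)

module Torus (N : ℕ) .{{_ : NonZero N}} where
  open BML N
  open ≡-Reasoning

  %-absorbˡ : ∀ a b → (a % N + b) % N ≡ (a + b) % N
  %-absorbˡ a b = begin
    (a % N + b) % N          ≡⟨ %-distribˡ-+ (a % N) b N ⟩
    (a % N % N + b % N) % N  ≡⟨ cong (λ v → (v + b % N) % N) (m%n%n≡m%n a N) ⟩
    (a % N + b % N) % N      ≡⟨ %-distribˡ-+ a b N ⟨
    (a + b) % N              ∎

  %-absorbʳ : ∀ a b → (a + b % N) % N ≡ (a + b) % N
  %-absorbʳ a b = begin
    (a + b % N) % N  ≡⟨ cong (_% N) (+-comm a (b % N)) ⟩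
    (b % N + a) % N  ≡⟨ %-absorbˡ b a ⟩
    (b + a) % N      ≡⟨ cong (_% N) (+-comm b a) ⟩
    (a + b) % N      ∎

  [N∸t%N]+t≡[1+t/N]*N : ∀ t → (N ∸ t % N) + t ≡ suc (t / N) * N
  [N∸t%N]+t≡[1+t/N]*N t = begin
    (N ∸ t % N) + t                        ≡⟨ cong ((N ∸ t % N) +_) (m≡m%n+[m/n]*n t N) ⟩
    (N ∸ t % N) + (t % N + (t / N) * N)    ≡⟨ +-assoc (N ∸ t % N) (t % N) _ ⟨
    (N ∸ t % N) + t % N + (t / N) * N      ≡⟨ cong (_+ (t / N) * N) (m∸n+n≡m (<⇒≤ (m%n<n t N))) ⟩
    N + (t / N) * N                        ∎

  toℕ-⊕ : ∀ i k → toℕ (i ⊕ k) ≡ (toℕ i + k) % N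
  toℕ-⊕ i k = toℕ-fromℕ< (m%n<n (toℕ i + k) N)

  ⊕-cong : ∀ i k j l → (toℕ i + k) % N ≡ (toℕ j + l) % N → i ⊕ k ≡ j ⊕ l
  ⊕-cong i k j l eq = fromℕ<-cong _ _ eq _ _

  ⊕-assoc : ∀ i a b → (i ⊕ a) ⊕ b ≡ i ⊕ (a + b)
  ⊕-assoc i a b = ⊕-cong (i ⊕ a) b i (a + b) (begin
    (toℕ (i ⊕ a) + b) % N       ≡⟨ cong (λ v → (v + b) % N) (toℕ-⊕ i a) ⟩
    ((toℕ i + a) % N + b) % N   ≡⟨ %-absorbˡ (toℕ i + a) b ⟩
    (toℕ i + a + b) % N         ≡⟨ cong (_% N) (+-assoc (toℕ i) a b) ⟩
    (toℕ i + (a + b)) % N       ∎)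

  ⊕-swap : ∀ i a b → (i ⊕ a) ⊕ b ≡ (i ⊕ b) ⊕ a
  ⊕-swap i a b = begin
    (i ⊕ a) ⊕ b  ≡⟨ ⊕-assoc i a b ⟩
    i ⊕ (a + b)  ≡⟨ cong (i ⊕_) (+-comm a b) ⟩
    i ⊕ (b + a)  ≡⟨ ⊕-assoc i b a ⟨
    (i ⊕ b) ⊕ a  ∎

  ⊕-multiple : ∀ i q → i ⊕ (q * N) ≡ i
  ⊕-multiple i q = toℕ-injective (begin
    toℕ (i ⊕ (q * N))      ≡⟨ toℕ-⊕ i (q * N) ⟩
    (toℕ i + q * N) % N    ≡⟨ [m+kn]%n≡m%n (toℕ i) q N ⟩
    toℕ i % N              ≡⟨ m<n⇒m%n≡m (toℕ<n i) ⟩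
    toℕ i                  ∎)

  ⊕-identityʳ : ∀ i → i ⊕ 0 ≡ i
  ⊕-identityʳ i = ⊕-multiple i 0

  ⊕-N : ∀ i → i ⊕ N ≡ i
  ⊕-N i = trans (cong (i ⊕_) (sym (*-identityˡ N))) (⊕-multiple i 1)

  ⊕-cancelʳ : ∀ {i j} k → i ⊕ k ≡ j ⊕ k → i ≡ j
  ⊕-cancelʳ {i} {j} k eq = begin
    i                          ≡⟨ undo i ⟨
    (i ⊕ k) ⊕ (k * N ∸ k)      ≡⟨ cong (_⊕ (k * N ∸ k)) eq ⟩
    (j ⊕ k) ⊕ (k * N ∸ k)      ≡⟨ undo j ⟩
    j                          ∎
    where
      undo : ∀ i → (i ⊕ k) ⊕ (k * N ∸ k) ≡ i
      undo i = trans (⊕-assoc i k _) (trans (cong (i ⊕_) (m+[n∸m]≡n (m≤m*n k N))) (⊕-multiple i k))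

  toℕ-⊕1 : ∀ w → toℕ (w ⊕ 1) ≢ 0 → toℕ (w ⊕ 1) ≡ suc (toℕ w)
  toℕ-⊕1 w ≢0 with suc (toℕ w) <? N
  ... | yes 1+w<N = trans (toℕ-⊕ w 1) (trans (cong (_% N) (+-comm (toℕ w) 1)) (m<n⇒m%n≡m 1+w<N))
  ... | no  1+w≮N = contradiction wraps ≢0
    where
      wraps : toℕ (w ⊕ 1) ≡ 0
      wraps = begin
        toℕ (w ⊕ 1)        ≡⟨ toℕ-⊕ w 1 ⟩
        (toℕ w + 1) % N    ≡⟨ cong (_% N) (+-comm (toℕ w) 1) ⟩
        suc (toℕ w) % N    ≡⟨ cong (_% N) (≤-antisym (toℕ<n w) (≮⇒≥ 1+w≮N)) ⟩
        N % N              ≡⟨ n%n≡0 N ⟩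
        0                  ∎

  offset : Fin N → Fin N → Fin N
  offset p y = y ⊕ (N ∸ toℕ p)

  offset-≡0 : ∀ p y → toℕ (offset p y) ≡ 0 → y ≡ p
  offset-≡0 p y ≡0 = toℕ-injective (begin
    toℕ y                                ≡⟨ cong toℕ restore ⟨
    toℕ (offset p y ⊕ toℕ p)             ≡⟨ toℕ-⊕ (offset p y) (toℕ p) ⟩
    (toℕ (offset p y) + toℕ p) % N       ≡⟨ cong (λ v → (v + toℕ p) % N) ≡0 ⟩
    toℕ p % N                            ≡⟨ m<n⇒m%n≡m (toℕ<n p) ⟩
    toℕ p                                ∎)
    where
      restore : offset p y ⊕ toℕ p ≡ y
      restore = trans (⊕-assoc y _ (toℕ p)) (trans (cong (y ⊕_) (m∸n+n≡m (<⇒≤ (toℕ<n p)))) (⊕-N y))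

  toℕ-offset-⊕1 : ∀ p z → z ⊕ 1 ≢ p → toℕ (offset p (z ⊕ 1)) ≡ suc (toℕ (offset p z))
  toℕ-offset-⊕1 p z z⊕1≢p =
    trans (cong toℕ commute) (toℕ-⊕1 (offset p z) (z⊕1≢p ∘ offset-≡0 p (z ⊕ 1) ∘ trans (cong toℕ commute)))
    where
      commute : offset p (z ⊕ 1) ≡ offset p z ⊕ 1
      commute = ⊕-swap z 1 (N ∸ toℕ p)

  advance : Colour → ℕ → Site → Site
  advance red  k (i , j) = i ⊕ k , j
  advance blue k (i , j) = i , j ⊕ k

  advance-zero : ∀ κ s → advance κ 0 s ≡ s
  advance-zero red  (i , j) = cong (_, j) (⊕-identityʳ i)
  advance-zero blue (i , j) = cong (i ,_) (⊕-identityʳ j)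

  advance-N : ∀ κ s → advance κ N s ≡ s
  advance-N red  (i , j) = cong (_, j) (⊕-N i)
  advance-N blue (i , j) = cong (i ,_) (⊕-N j)

  advance-suc : ∀ κ k s → advance κ 1 (advance κ k s) ≡ advance κ (suc k) s
  advance-suc red  k (i , j) = cong (_, j) (trans (⊕-assoc i k 1) (cong (i ⊕_) (+-comm k 1)))
  advance-suc blue k (i , j) = cong (i ,_) (trans (⊕-assoc j k 1) (cong (j ⊕_) (+-comm k 1)))

  diagonal : Site → Fin N
  diagonal (a , b) = a ⊕ toℕ b

  diagonal-advance : ∀ κ k s → diagonal (advance κ k s) ≡ diagonal s ⊕ k
  diagonal-advance red  k (a , b) = ⊕-swap a k (toℕ b)
  diagonal-advance blue k (a , b) = ⊕-cong a (toℕ (b ⊕ k)) (a ⊕ toℕ b) k (begin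
    (toℕ a + toℕ (b ⊕ k)) % N      ≡⟨ cong (λ v → (toℕ a + v) % N) (toℕ-⊕ b k) ⟩
    (toℕ a + (toℕ b + k) % N) % N  ≡⟨ %-absorbʳ (toℕ a) (toℕ b + k) ⟩
    (toℕ a + (toℕ b + k)) % N      ≡⟨ cong (_% N) (+-assoc (toℕ a) (toℕ b) k) ⟨
    (toℕ a + toℕ b + k) % N        ≡⟨ %-absorbˡ (toℕ a + toℕ b) k ⟨
    ((toℕ a + toℕ b) % N + k) % N  ≡⟨ cong (λ v → (v + k) % N) (toℕ-⊕ a (toℕ b)) ⟨
    (toℕ (a ⊕ toℕ b) + k) % N      ∎)

module Substeps (N : ℕ) .{{_ : NonZero N}} (m : ℕ) (col : Fin m → Colour) where
  open BML N
  open Cars m col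
  open Torus N

  other : Colour → Colour
  other red  = blue
  other blue = red

  colour-cases : ∀ κ κ′ → κ′ ≡ κ ⊎ κ′ ≡ other κ
  colour-cases red  red  = inj₁ refl
  colour-cases red  blue = inj₂ refl
  colour-cases blue red  = inj₂ refl
  colour-cases blue blue = inj₁ refl

  -- BlueBlocked, RedBlocked, BlueSubstep and RedSubstep are definitionally the
  -- instances κ = blue and κ = red of these two definitions.
  Jammed : Colour → Config m → Fin m → Set
  Jammed κ x c = ∃ λ k →
    (∀ l → 1 ≤ l → l ≤ k → Holds x (advance κ l (x c)) κ) × Holds x (advance κ (suc k) (x c)) (other κ)

  Substep : Colour → Config m → Config m → Set
  Substep κ x x′ = ∀ c →
    (col c ≡ other κ → x′ c ≡ x c)
    × (col c ≡ κ → Jammed κ x c → x′ c ≡ x c)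
    × (col c ≡ κ → ¬ Jammed κ x c → x′ c ≡ advance κ 1 (x c))

  module _ {κ x x′} (step : Substep κ x x′) (c : Fin m) where
    idle : col c ≡ other κ → x′ c ≡ x c
    idle = proj₁ (step c)

    stuck : col c ≡ κ → Jammed κ x c → x′ c ≡ x c
    stuck = proj₁ (proj₂ (step c))

    moves : col c ≡ κ → ¬ Jammed κ x c → x′ c ≡ advance κ 1 (x c)
    moves = proj₂ (proj₂ (step c))

  Holds-resp : ∀ {x x′ s κ} → x ≗ x′ → Holds x s κ → Holds x′ s κ
  Holds-resp x≗x′ (d , xd≡s , colour) = d , trans (sym (x≗x′ d)) xd≡s , colour

  Jammed-resp : ∀ {κ x x′ c} → x ≗ x′ → Jammed κ x c → Jammed κ x′ c
  Jammed-resp {κ} {x} {x′} {c} x≗x′ (k , run , stop) =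
    k , (λ l 1≤l l≤k → transport (run l 1≤l l≤k)) , transport stop
    where
      transport : ∀ {l κ′} → Holds x (advance κ l (x c)) κ′ → Holds x′ (advance κ l (x′ c)) κ′
      transport {l} {κ′} = subst (λ s → Holds x′ (advance κ l s) κ′) (x≗x′ c) ∘ Holds-resp x≗x′

  jammed⇒ahead-occupied : ∀ {κ x c} → Jammed κ x c → ∃ λ d → x d ≡ advance κ 1 (x c)
  jammed⇒ahead-occupied (zero  , _   , (d , ahead , _)) = d , ahead
  jammed⇒ahead-occupied (suc k , run , _) with run 1 ≤-refl (s≤s z≤n)
  ... | d , ahead , _ = d , ahead

  Substep-deterministic : ∀ κ {x x′ z z′} → x ≗ x′ → Substep κ x z → Substep κ x′ z′ → z ≗ z′
  Substep-deterministic κ {x} {x′} {z} {z′} x≗x′ step step′ c with colour-cases κ (col c)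
  ... | inj₂ passive = trans (idle step c passive) (trans (x≗x′ c) (sym (idle step′ c passive)))
  ... | inj₁ active  = by-cases (≡-dec _≟_ _≟_ (z c) (z′ c)) jammed free
    where
      jammed : Jammed κ x c → z c ≡ z′ c
      jammed j = trans (stuck step c active j)
                       (trans (x≗x′ c) (sym (stuck step′ c active (Jammed-resp x≗x′ j))))
      free : ¬ Jammed κ x c → z c ≡ z′ c
      free ¬j = trans (moves step c active ¬j)
                      (trans (cong (advance κ 1) (x≗x′ c))
                             (sym (moves step′ c active (¬j ∘ Jammed-resp (sym ∘ x≗x′)))))

module Dynamics (N : ℕ) .{{_ : NonZero N}} (m : ℕ) (col : Fin m → Colour)
                (tr : BML.Cars.Trajectory N m col) where
  open BML N
  open Cars m col
  open Trajectory tr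
  open Torus N
  open Substeps N m col

  Z-determined : ∀ {t t′} → X t ≗ X t′ → Z t ≗ Z t′
  Z-determined X≗ = Substep-deterministic blue X≗ (blueStep _) (blueStep _)

  X-determined : ∀ {t t′} → X t ≗ X t′ → X (suc t) ≗ X (suc t′)
  X-determined X≗ = Substep-deterministic red (Z-determined X≗) (redStep _) (redStep _)

  Blocked-resp : ∀ {t t′ c} → X t ≗ X t′ → Blocked tr c t → Blocked tr c t′
  Blocked-resp X≗ (inj₁ (isBlue , jam)) = inj₁ (isBlue , Jammed-resp X≗ jam)
  Blocked-resp X≗ (inj₂ (isRed  , jam)) = inj₂ (isRed  , Jammed-resp (Z-determined X≗) jam)

  periodic-from : ∀ s → X (s + N) ≗ X s → ∀ t → s ≤ t → X (t + N) ≗ X t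
  periodic-from s period t s≤t = subst (λ u → X (u + N) ≗ X u) (m∸n+n≡m s≤t) (shifted (t ∸ s))
    where
      shifted : ∀ k → X (k + s + N) ≗ X (k + s)
      shifted zero    = period
      shifted (suc k) = X-determined (shifted k)

  blocked-stays : ∀ c t → Blocked tr c t → X (suc t) c ≡ X t c
  blocked-stays c t (inj₁ (isBlue , jam)) =
    trans (idle (redStep t) c isBlue) (stuck (blueStep t) c isBlue jam)
  blocked-stays c t (inj₂ (isRed  , jam)) =
    trans (stuck (redStep t) c isRed jam) (idle (blueStep t) c isRed)

  unblocked-advances : ∀ c t → ¬ Blocked tr c t → X (suc t) c ≡ advance (col c) 1 (X t c)
  unblocked-advances c t free = by-colour (col c) refl
    where
      by-colour : ∀ κ → col c ≡ κ → X (suc t) c ≡ advance κ 1 (X t c)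
      by-colour blue isBlue = trans (idle (redStep t) c isBlue)
                                    (moves (blueStep t) c isBlue (free ∘ inj₁ ∘ (isBlue ,_)))
      by-colour red  isRed  = trans (moves (redStep t) c isRed (free ∘ inj₂ ∘ (isRed ,_)))
                                    (cong (advance red 1) (idle (blueStep t) c isRed))

  FreeWindow : ℕ → ℕ → Set
  FreeWindow s k = ∀ u → s ≤ u → u < k + s → ∀ c → ¬ Blocked tr c u

  free-window-advances : ∀ s k → FreeWindow s k → ∀ c → X (k + s) c ≡ advance (col c) k (X s c)
  free-window-advances s zero    _    c = sym (advance-zero (col c) (X s c))
  free-window-advances s (suc k) free c = begin
    X (suc (k + s)) c                              ≡⟨ unblocked-advances c (k + s) (free (k + s) (m≤n+m s k) ≤-refl c) ⟩
    advance (col c) 1 (X (k + s) c)                ≡⟨ cong (advance (col c) 1) (free-window-advances s k shorter c) ⟩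
    advance (col c) 1 (advance (col c) k (X s c))  ≡⟨ advance-suc (col c) k (X s c) ⟩
    advance (col c) (suc k) (X s c)                ∎
    where
      open ≡-Reasoning
      shorter : FreeWindow s k
      shorter u s≤u u<k+s = free u s≤u (m<n⇒m<1+n u<k+s)

  free-window⇒speed-one : ∀ s → FreeWindow s N → AttainsSpeedOne tr
  free-window⇒speed-one s free = s , λ t s≤t c →
    absent-by-periodicity {P = Blocked tr c}
      (λ u s≤u → Blocked-resp (periodic-from s period u s≤u))
      (λ u s≤u u<N+s → free u s≤u u<N+s c)
      t s≤t
    where
      period : X (s + N) ≗ X s
      period c = trans (cong (λ u → X u c) (+-comm s N))
                       (trans (free-window-advances s N free c) (advance-N (col c) (X s c)))

  φ-⊕-time : ∀ t s → φ tr t s ⊕ t ≡ diagonal s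
  φ-⊕-time t (a , b) = ⊕-cong (φ tr t (a , b)) t a (toℕ b) (begin
    (toℕ (φ tr t (a , b)) + t) % N                ≡⟨ cong (λ v → (v + t) % N) (toℕ-fromℕ< _) ⟩
    ((toℕ a + toℕ b + (N ∸ t % N)) % N + t) % N   ≡⟨ %-absorbˡ (toℕ a + toℕ b + (N ∸ t % N)) t ⟩
    (toℕ a + toℕ b + (N ∸ t % N) + t) % N         ≡⟨ cong (_% N) (+-assoc (toℕ a + toℕ b) (N ∸ t % N) t) ⟩
    (toℕ a + toℕ b + ((N ∸ t % N) + t)) % N       ≡⟨ cong (λ v → (toℕ a + toℕ b + v) % N) ([N∸t%N]+t≡[1+t/N]*N t) ⟩
    (toℕ a + toℕ b + suc (t / N) * N) % N         ≡⟨ [m+kn]%n≡m%n (toℕ a + toℕ b) (suc (t / N)) N ⟩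
    (toℕ a + toℕ b) % N                           ∎)
    where open ≡-Reasoning

  φ-advance : ∀ κ t s → φ tr t (advance κ 1 s) ≡ φ tr t s ⊕ 1
  φ-advance κ t s = ⊕-cancelʳ t (begin
    φ tr t (advance κ 1 s) ⊕ t  ≡⟨ φ-⊕-time t (advance κ 1 s) ⟩
    diagonal (advance κ 1 s)    ≡⟨ diagonal-advance κ 1 s ⟩
    diagonal s ⊕ 1              ≡⟨ cong (_⊕ 1) (φ-⊕-time t s) ⟨
    (φ tr t s ⊕ t) ⊕ 1          ≡⟨ ⊕-swap (φ tr t s) t 1 ⟩
    (φ tr t s ⊕ 1) ⊕ t          ∎)
    where open ≡-Reasoning

  φ-suc : ∀ t s → φ tr (suc t) s ⊕ 1 ≡ φ tr t s
  φ-suc t s = ⊕-cancelʳ t (begin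
    (φ tr (suc t) s ⊕ 1) ⊕ t  ≡⟨ ⊕-assoc (φ tr (suc t) s) 1 t ⟩
    φ tr (suc t) s ⊕ suc t    ≡⟨ φ-⊕-time (suc t) s ⟩
    diagonal s                ≡⟨ φ-⊕-time t s ⟨
    φ tr t s ⊕ t              ∎)
    where open ≡-Reasoning

  φ-suc-advance : ∀ κ t s → φ tr (suc t) (advance κ 1 s) ≡ φ tr t s
  φ-suc-advance κ t s = ⊕-cancelʳ 1 (trans (φ-suc t (advance κ 1 s)) (φ-advance κ t s))

  Y-blocked : ∀ c t → Blocked tr c t → Y tr c (suc t) ⊕ 1 ≡ Y tr c t
  Y-blocked c t blocked = trans (cong (λ s → φ tr (suc t) s ⊕ 1) (blocked-stays c t blocked)) (φ-suc t (X t c))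

  Y-unblocked : ∀ c t → ¬ Blocked tr c t → Y tr c (suc t) ≡ Y tr c t
  Y-unblocked c t free = trans (cong (φ tr (suc t)) (unblocked-advances c t free)) (φ-suc-advance (col c) t (X t c))

  Y-step : ∀ c t → Y tr c (suc t) ≡ Y tr c t ⊎ Y tr c (suc t) ⊕ 1 ≡ Y tr c t
  Y-step c t = by-cases ((Y tr c (suc t) ≟ Y tr c t) ⊎-dec (Y tr c (suc t) ⊕ 1 ≟ Y tr c t))
                        (inj₂ ∘ Y-blocked c t) (inj₁ ∘ Y-unblocked c t)

  InS? : ∀ t y → Dec (InS tr t y)
  InS? t y = any? (λ c → Y tr c t ≟ y)

  occupied : ∀ {t d s} → X t d ≡ s → InS tr t (φ tr t s)
  occupied {t} {d} at = d , cong (φ tr t) at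

  -- A red car is blocked by the car above it after the blue substep: a red one
  -- was already there at time t, a blue one stays there until time t + 1.
  blocked-by-neighbour : ∀ c t → Blocked tr c t → InS tr t (Y tr c t ⊕ 1) ⊎ InS tr (suc t) (Y tr c t)
  blocked-by-neighbour c t (inj₁ (isBlue , jam)) with jammed⇒ahead-occupied jam
  ... | d , ahead = inj₁ (subst (InS tr t) (φ-advance blue t (X t c)) (occupied ahead))
  blocked-by-neighbour c t (inj₂ (isRed , jam)) with jammed⇒ahead-occupied jam
  ... | d , ahead with colour-cases red (col d) | trans ahead (cong (advance red 1) (idle (blueStep t) c isRed))
  ...   | inj₁ isRed′ | above = inj₁ (subst (InS tr t) (φ-advance red t (X t c))
                                       (occupied (trans (sym (idle (blueStep t) d isRed′)) above)))
  ...   | inj₂ isBlue | above = inj₂ (subst (InS tr (suc t)) (φ-suc-advance red t (X t c))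
                                       (occupied (trans (idle (redStep t) d isBlue) above)))

  occupied-persists : ∀ t y → InS tr t y → ¬ InS tr t (y ⊕ 1) → InS tr (suc t) y
  occupied-persists t _ (c , refl) vacant =
    by-cases (InS? (suc t) (Y tr c t))
      (fromInj₂ (λ ahead → contradiction ahead vacant) ∘ blocked-by-neighbour c t)
      (λ free → c , Y-unblocked c t free)

  EmptyPair : ℕ → Fin N → Set
  EmptyPair t p = ¬ InS tr t p × ¬ InS tr t (p ⊕ 1)

  empty-pair-backward : ∀ t p → EmptyPair (suc t) p → EmptyPair t p
  empty-pair-backward t p (p-empty , p⊕1-empty) = p-was-empty , p⊕1-was-empty
    where
      p⊕1-was-empty : ¬ InS tr t (p ⊕ 1)
      p⊕1-was-empty (c , at) with Y-step c t
      ... | inj₁ stays = p⊕1-empty (c , trans stays at)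
      ... | inj₂ drops = p-empty (c , ⊕-cancelʳ 1 (trans drops at))
      p-was-empty : ¬ InS tr t p
      p-was-empty occ = p-empty (occupied-persists t p occ p⊕1-was-empty)

  empty-pair-before : ∀ {t K} p → t ≤ K → EmptyPair K p → EmptyPair t p
  empty-pair-before p t≤K = go (≤⇒≤′ t≤K)
    where
      go : ∀ {t K} → t ≤′ K → EmptyPair K p → EmptyPair t p
      go ≤′-refl        = id
      go (≤′-step t≤′K) = go t≤′K ∘ empty-pair-backward _ p

  module Potential (p : Fin N) {K} (empty : EmptyPair K p) (slow : ¬ AttainsSpeedOne tr) where
    height : Fin m → ℕ → ℕ
    height c t = toℕ (offset p (Y tr c t))

    potential : ℕ → ℕ
    potential t = sum (λ c → height c t)

    height-drop : ∀ c t → t ≤ K → Y tr c (suc t) ⊕ 1 ≡ Y tr c t → height c t ≡ suc (height c (suc t))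
    height-drop c t t≤K drops = begin
      toℕ (offset p (Y tr c t))            ≡⟨ cong (toℕ ∘ offset p) drops ⟨
      toℕ (offset p (Y tr c (suc t) ⊕ 1))  ≡⟨ toℕ-offset-⊕1 p _ (p-vacant ∘ (c ,_) ∘ trans (sym drops)) ⟩
      suc (height c (suc t))               ∎
      where
        open ≡-Reasoning
        p-vacant : ¬ InS tr t p
        p-vacant = proj₁ (empty-pair-before p t≤K empty)

    height-step : ∀ c t → t ≤ K → height c (suc t) ≤ height c t
    height-step c t t≤K with Y-step c t
    ... | inj₁ stays = ≤-reflexive (cong (toℕ ∘ offset p) stays)
    ... | inj₂ drops = ≤-trans (n≤1+n _) (≤-reflexive (sym (height-drop c t t≤K drops)))

    potential-step : ∀ t → t < K → potential (suc t) ≤ potential t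
    potential-step t t<K = sum-mono-≤ (λ c → height-step c t (<⇒≤ t<K))

    flat⇒unblocked : ∀ t → t ≤ K → potential (suc t) ≡ potential t → ∀ c → ¬ Blocked tr c t
    flat⇒unblocked t t≤K flat c blocked = <-irrefl flat
      (sum-mono-< (λ c′ → height-step c′ t t≤K) c
                  (≤-reflexive (sym (height-drop c t t≤K (Y-blocked c t blocked)))))

    window-drop : ∀ s → s + N ≤ K → potential (s + N) < potential s
    window-drop s s+N≤K = ≤∧≢⇒< (antitone-on potential-step (m≤m+n s N) s+N≤K)
                                (slow ∘ free-window⇒speed-one s ∘ free)
      where
        free : potential (s + N) ≡ potential s → FreeWindow s N
        free flat u s≤u u<N+s = flat⇒unblocked u (<⇒≤ u<K) (≤-antisym (potential-step u u<K) (begin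
          potential u         ≤⟨ antitone-on potential-step s≤u (<⇒≤ u<K) ⟩
          potential s         ≡⟨ flat ⟨
          potential (s + N)   ≤⟨ antitone-on potential-step u<s+N s+N≤K ⟩
          potential (suc u)   ∎))
          where
            open ≤-Reasoning
            u<s+N : u < s + N
            u<s+N = subst (u <_) (+-comm N s) u<N+s
            u<K : u < K
            u<K = <-≤-trans u<s+N s+N≤K

  no-late-empty-pair : ¬ AttainsSpeedOne tr → ∀ p → ¬ EmptyPair (suc (m * N) * N) p
  no-late-empty-pair slow p empty = 1+n≰n (begin
    suc (m * N)                                  ≤⟨ m≤m+n (suc (m * N)) _ ⟩
    suc (m * N) + potential (suc (m * N) * N)    ≤⟨ descent-by-windows window-drop (suc (m * N)) ≤-refl ⟩
    potential 0                                  ≤⟨ sum-≤-* (λ c → <⇒≤ (toℕ<n (offset p (Y tr c 0)))) ⟩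
    m * N                                        ∎)
    where
      open Potential p empty slow
      open ≤-Reasoning

lemma4 : (N : ℕ) .{{nz : NonZero N}} (m : ℕ) → m < N * N →
         (col : Fin m → Colour) →
         (tr : BML.Cars.Trajectory N m col) →
         Injective _≡_ _≡_ (BML.Cars.Trajectory.X tr 0) →
         ¬ BML.Cars.AttainsSpeedOne N m col tr →
         ∃ λ T → ∀ y l → BML.Cars.MaxEmptyArc N m col tr T y l → l ≡ 0
lemma4 N m _ col tr _ slow = T , arcs-are-points
  where
    open BML N
    open Cars m col
    open Torus N
    open Dynamics N m col tr

    T : ℕ
    T = suc (m * N) * N

    arcs-are-points : ∀ y l → MaxEmptyArc tr T y l → l ≡ 0
    arcs-are-points y zero    _            = refl
    arcs-are-points y (suc l) (vacant , _) =
      contradiction (vacant 0 z≤n ∘ subst (InS tr T) (sym (⊕-identityʳ y)) , vacant 1 (s≤s z≤n))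
                    (no-late-empty-pair slow y)
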